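{- Let $d\ge1$ and $k\ge2^d$ be integers, let $V$ be a $d'$-dimensional vector space over $\mathbb{F}_2$ ($d'\ge1$), and let $S\subseteq V$ with $|S|=k$. Let $p$ be the probability that a uniformly random linear map $\varphi\colon V\to\mathbb{F}_2^d$ satisfies $\varphi(S)=\mathbb{F}_2^d$. Then there exists a $k\times(2^{d'}-1)$ binary matrix with exactly $2^{dd'}p/d!$ shattered $k\times d$ submatrices. In particular, \[c(k,d)\ge\left(\frac{2^{d'}}{2^{d'}-1}\right)^d p.\]
   Context: A $k\times d$ binary matrix is shattered if each vector in $\{0,1\}^d$ appears among its rows; a $k\times d$ submatrix of a $k\times n$ matrix is given by choosing $d$ of its columns. $H(k,d)$ is the $d$-uniform hypergraph on vertex set $\{0,1\}^k$ whose edges are the sets of $d$ distinct vectors forming, as columns, a shattered $k\times d$ matrix. The Lagrangian $\lambda(H)$ is the maximum of $\sum_{e\in E(H)}\prod_{v\in e}x_v$ over $x_v\ge0$, $\sum_vx_v=1$, and $c(k,d)=d!\,\lambda(H(k,d))$. -}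

module Defs where

open import Data.Bool using (Bool; true; false; _∧_; _xor_)
open import Data.Bool.Properties using () renaming (_≟_ to _≟ᵇ_)
open import Data.Nat using (ℕ; zero; suc)
open import Data.Nat using (_!)
open import Data.Fin using (Fin)
open import Data.Fin.Properties using (any?)
open import Data.Vec using (Vec; []; _∷_; lookup; toList; foldr; zipWith)
import Data.Vec as V
open import Data.Vec.Properties using () renaming (≡-dec to vec-≡-dec)
open import Data.List using (List; []; _∷_; _++_; length; filter; concatMap)
import Data.List as L
open import Data.List.Properties using () renaming (≡-dec to list-≡-dec)
open import Data.Product using (_×_; _,_; ∃; proj₁; proj₂)
open import Data.Integer using (+_)
open import Data.Rational using (ℚ; 0ℚ; 1ℚ; _/_; _*_; _+_; _≤_; _<_)
open import Relation.Nullary using (Dec; yes; no; ¬_)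
open import Relation.Unary using (Pred; Decidable)
open import Relation.Binary.PropositionalEquality using (_≡_)

allVecsOf : {A : Set} → List A → (n : ℕ) → List (Vec A n)
allVecsOf xs zero    = [] ∷ []
allVecsOf xs (suc n) = concatMap (λ x → L.map (x ∷_) (allVecsOf xs n)) xs

allBVecs : (n : ℕ) → List (Vec Bool n)
allBVecs = allVecsOf (false ∷ true ∷ [])

-- all sublists of length d of a list (choosing d of its positions; each
-- choice of d positions appears exactly once)
choose : {A : Set} → ℕ → List A → List (List A)
choose zero    _        = [] ∷ []
choose (suc d) []       = []
choose (suc d) (x ∷ xs) = L.map (x ∷_) (choose d xs) ++ choose (suc d) xs

∀-BVec? : (n : ℕ) {P : Vec Bool n → Set} → Decidable P → Dec (∀ v → P v)
∀-BVec? zero P? with P? []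
... | yes p = yes λ { [] → p }
... | no ¬p = no λ f → ¬p (f [])
∀-BVec? (suc n) P? with ∀-BVec? n (λ w → P? (false ∷ w)) | ∀-BVec? n (λ w → P? (true ∷ w))
... | yes f | yes t = yes λ { (false ∷ w) → f w ; (true ∷ w) → t w }
... | no ¬f | _     = no λ g → ¬f (λ w → g (false ∷ w))
... | yes _ | no ¬t = no λ g → ¬t (λ w → g (true ∷ w))

-- A k × m binary matrix is given by the list (or vector) of its m columns,
-- each column being a vector in {0,1}^k.

rowOf : {k : ℕ} → List (Vec Bool k) → Fin k → List Bool
rowOf cols i = L.map (λ c → lookup c i) cols

Shattered : {k : ℕ} (d : ℕ) → List (Vec Bool k) → Set
Shattered {k} d cols = (v : Vec Bool d) → ∃ λ (i : Fin k) → rowOf cols i ≡ toList v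

shattered? : {k : ℕ} (d : ℕ) → Decidable (Shattered {k} d)
shattered? d cols =
  ∀-BVec? d (λ v → any? (λ i → list-≡-dec _≟ᵇ_ (rowOf cols i) (toList v)))

numShattered : {k m : ℕ} (d : ℕ) → Vec (Vec Bool k) m → ℕ
numShattered d M = length (filter (shattered? d) (choose d (toList M)))

-- Linear maps F_2^{d'} → F_2^d, represented by their d × d' matrices
-- (given as the list of d rows)

LinMap : ℕ → ℕ → Set
LinMap d d' = Vec (Vec Bool d') d

dot : {n : ℕ} → Vec Bool n → Vec Bool n → Bool
dot u x = foldr _ _xor_ false (zipWith _∧_ u x)

apply : {d d' : ℕ} → LinMap d d' → Vec Bool d' → Vec Bool d
apply A x = V.map (λ u → dot u x) A

allLinMaps : (d d' : ℕ) → List (LinMap d d')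
allLinMaps d d' = allVecsOf (allBVecs d') d

MapsOnto : {d d' k : ℕ} → Vec (Vec Bool d') k → LinMap d d' → Set
MapsOnto {d} {d'} {k} S A = (y : Vec Bool d) → ∃ λ (i : Fin k) → apply A (lookup S i) ≡ y

mapsOnto? : {d d' k : ℕ} (S : Vec (Vec Bool d') k) → Decidable (MapsOnto {d} S)
mapsOnto? {d} S A =
  ∀-BVec? d (λ y → any? (λ i → vec-≡-dec _≟ᵇ_ (apply A (lookup S i)) y))

numOnto : {d' k : ℕ} (d : ℕ) → Vec (Vec Bool d') k → ℕ
numOnto {d'} d S = length (filter (mapsOnto? S) (allLinMaps d d'))

ℕtoℚ : ℕ → ℚ
ℕtoℚ n = + n / 1

-- n / m as a rational, with the (unused here) convention n / 0 = 0
frac : ℕ → ℕ → ℚ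
frac n zero    = 0ℚ
frac n (suc m) = + n / suc m

powℚ : ℚ → ℕ → ℚ
powℚ q zero    = 1ℚ
powℚ q (suc n) = q * powℚ q n

sumℚ : List ℚ → ℚ
sumℚ = L.foldr _+_ 0ℚ

prodℚ : List ℚ → ℚ
prodℚ = L.foldr _*_ 1ℚ

-- edges of H(k,d): sets of d distinct vertices of {0,1}^k (listed as
-- sublists of the duplicate-free enumeration allBVecs k) which, as
-- columns, form a shattered k × d matrix
edgesH : (k d : ℕ) → List (List (Vec Bool k))
edgesH k d = filter (shattered? d) (choose d (allBVecs k))

lagPoly : (k d : ℕ) → (Vec Bool k → ℚ) → ℚ
lagPoly k d x = sumℚ (L.map (λ e → prodℚ (L.map x e)) (edgesH k d))

-- c(k,d) = d! λ(H(k,d)) ≥ r, i.e. sup over the simplex of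
-- d! · lagPoly ≥ r (the sup is a max by compactness); expressed with
-- rational points of the simplex via an ε-approximation, which is
-- equivalent by density of ℚ and continuity.
cAtLeast : (k d : ℕ) → ℚ → Set
cAtLeast k d r =
  (ε : ℚ) → 0ℚ < ε →
  ∃ λ (x : Vec Bool k → ℚ) →
    ((v : Vec Bool k) → 0ℚ ≤ x v) ×
    (sumℚ (L.map x (allBVecs k)) ≡ 1ℚ) ×
    (r < ℕtoℚ (d !) * lagPoly k d x + ε)

-- Give the columns of M the names u ∈ F₂^{d'} ∖ {0}, column u being (⟨u, sᵢ⟩)ᵢ.  If the linear map
-- φ has rows u₁, …, u_d, the i-th row of the submatrix with columns u₁, …, u_d is φ(sᵢ); so φ maps S
-- onto F₂^d exactly when that submatrix is shattered.  Shattering is a property of the set of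
-- columns which fails on any repeated column and on the zero column, and for such a property a sum
-- over d-tuples is d! times the sum over d-subsets.  This gives #onto maps = d! · #shattered
-- submatrices of M.  For the Lagrangian, give each v ∈ {0,1}^k the weight (multiplicity of v as a
-- column of M)/(2^{d'} − 1); the same tuple/subset comparison, applied to tuples of columns of M and
-- to tuples of distinct vertices weighted by multiplicities, turns d! times the Lagrangian polynomial
-- into #onto maps/(2^{d'} − 1)^d, which is (2^{d'}/(2^{d'} − 1))^d p.
module Submission where

open import Algebra.Properties.CommutativeSemigroup using (interchange; x∙yz≈y∙xz)
open import Data.Bool using (Bool; true; false; if_then_else_)
import Data.Bool.Properties as Boolₚ
open import Data.Empty using (⊥-elim)
open import Data.Fin using (Fin)
open import Data.List using (List; []; _∷_; _++_; map; length; filter; concatMap; drop)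
open import Data.List.Properties
  using (map-++; map-cong; map-∘; length-map; length-++; length-drop; ∷-injectiveˡ; ∷-injectiveʳ)
open import Data.List.Relation.Unary.All using (All; []; _∷_)
import Data.List.Relation.Unary.All as All
open import Data.List.Relation.Unary.All.Properties using (all-filter)
open import Data.Nat using (ℕ; zero; suc; _≤_; _^_; _∸_; _*_; _+_; _!; NonZero; >-nonZero; s≤s; z≤n)
open import Data.Nat.ListAction using (sum; product)
open import Data.Nat.ListAction.Properties using (sum-++)
open import Data.Nat.Properties
  using ( *-identityˡ; *-identityʳ; *-zeroʳ; *-comm; *-distribˡ-+; *-distribʳ-+; +-identityʳ
        ; *-cancelˡ-≡; _!≢0; m^n≢0; m*n≢0; ∸-monoˡ-≤; ^-monoʳ-≤; ^-*-assoc
        ; +-commutativeSemigroup; *-commutativeSemigroup )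
open import Data.Nat.Solver using (module +-*-Solver)
open import Data.Product using (Σ; _×_; _,_; proj₁; proj₂; map₂)
open import Data.Rational using (ℚ; 0ℚ; 1ℚ; fromℚᵘ)
  renaming (_*_ to _*ℚ_; _+_ to _+ℚ_; _≤_ to _≤ℚ_; _<_ to _<ℚ_)
import Data.Rational.Properties as ℚ
open import Data.Rational.Unnormalised using (mkℚᵘ; *≡*) renaming (_*_ to _*ᵘ_; _+_ to _+ᵘ_)
import Data.Rational.Unnormalised.Properties as ℚᵘ
open import Data.Vec using (Vec; []; _∷_; lookup; toList)
import Data.Vec as Vec
import Data.Vec.Properties as Vecₚ
open import Defs
open import Function using (_∘_)
open import Function.Bundles using (_⇔_; mk⇔)
open import Relation.Binary using (DecidableEquality)
open import Relation.Binary.PropositionalEquality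
  using (_≡_; refl; sym; trans; cong; cong₂; subst; module ≡-Reasoning)
open import Relation.Nullary using (Dec; yes; no; does; ¬_)
open import Relation.Nullary.Decidable using (dec-false; does-⇔)
open import Relation.Unary using (Decidable)

open ≡-Reasoning

∑ : {A : Set} → List A → (A → ℕ) → ℕ
∑ xs f = sum (map f xs)

syntax ∑ xs (λ x → e) = ∑[ x ∈ xs ] e

∏ : {A : Set} → List A → (A → ℕ) → ℕ
∏ xs f = product (map f xs)

indicator : {P : Set} → Dec P → ℕ
indicator P? = if does P? then 1 else 0

indicator-⇔ : {P Q : Set} → P ⇔ Q → (P? : Dec P) (Q? : Dec Q) → indicator P? ≡ indicator Q?
indicator-⇔ P⇔Q P? Q? = cong (if_then 1 else 0) (does-⇔ P⇔Q P? Q?)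

indicator-no : {P : Set} → ¬ P → (P? : Dec P) → indicator P? ≡ 0
indicator-no ¬p P? = cong (if_then 1 else 0) (dec-false P? ¬p)

module _ {A : Set} where

  ∑-++ : ∀ (f : A → ℕ) xs ys → ∑ (xs ++ ys) f ≡ ∑ xs f + ∑ ys f
  ∑-++ f xs ys = trans (cong sum (map-++ f xs ys)) (sum-++ (map f xs) (map f ys))

  ∑-cong : ∀ {f g : A → ℕ} xs → (∀ x → f x ≡ g x) → ∑ xs f ≡ ∑ xs g
  ∑-cong xs f≗g = cong sum (map-cong f≗g xs)

  ∑-zero : ∀ {f : A → ℕ} xs → (∀ x → f x ≡ 0) → ∑ xs f ≡ 0
  ∑-zero []       f≡0 = refl
  ∑-zero (x ∷ xs) f≡0 = cong₂ _+_ (f≡0 x) (∑-zero xs f≡0)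

  ∑-+ : ∀ (f g : A → ℕ) xs → ∑[ x ∈ xs ] (f x + g x) ≡ ∑ xs f + ∑ xs g
  ∑-+ f g []       = refl
  ∑-+ f g (x ∷ xs) = trans (cong ((f x + g x) +_) (∑-+ f g xs))
                           (interchange +-commutativeSemigroup (f x) (g x) (∑ xs f) (∑ xs g))

  ∑-*ˡ : ∀ c (f : A → ℕ) xs → ∑[ x ∈ xs ] (c * f x) ≡ c * ∑ xs f
  ∑-*ˡ c f []       = sym (*-zeroʳ c)
  ∑-*ˡ c f (x ∷ xs) = trans (cong (c * f x +_) (∑-*ˡ c f xs)) (sym (*-distribˡ-+ c (f x) (∑ xs f)))

  ∑-filter : ∀ {P : A → Set} (P? : Decidable P) (f : A → ℕ) xs →
             ∑ (filter P? xs) f ≡ ∑[ x ∈ xs ] (indicator (P? x) * f x)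
  ∑-filter P? f []       = refl
  ∑-filter P? f (x ∷ xs) with does (P? x)
  ... | true  = cong₂ _+_ (sym (+-identityʳ (f x))) (∑-filter P? f xs)
  ... | false = ∑-filter P? f xs

  length-filter : ∀ {P : A → Set} (P? : Decidable P) xs →
                  length (filter P? xs) ≡ ∑[ x ∈ xs ] indicator (P? x)
  length-filter P? []       = refl
  length-filter P? (x ∷ xs) with does (P? x)
  ... | true  = cong suc (length-filter P? xs)
  ... | false = length-filter P? xs

module _ {A B : Set} where

  ∑-map : ∀ (f : B → ℕ) (h : A → B) xs → ∑ (map h xs) f ≡ ∑ xs (f ∘ h)
  ∑-map f h xs = cong sum (sym (map-∘ xs))

  ∑-concatMap : ∀ (f : B → ℕ) (h : A → List B) xs → ∑ (concatMap h xs) f ≡ ∑[ x ∈ xs ] ∑ (h x) f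
  ∑-concatMap f h []       = refl
  ∑-concatMap f h (x ∷ xs) = trans (∑-++ f (h x) (concatMap h xs)) (cong (∑ (h x) f +_) (∑-concatMap f h xs))

swapAt : {A : Set} → ℕ → List A → List A
swapAt zero    (x ∷ y ∷ xs) = y ∷ x ∷ xs
swapAt (suc n) (x ∷ xs)     = x ∷ swapAt n xs
swapAt _       xs           = xs

module _ {A : Set} where

  swapAt-involutive : ∀ n (xs : List A) → swapAt n (swapAt n xs) ≡ xs
  swapAt-involutive zero    []           = refl
  swapAt-involutive zero    (x ∷ [])     = refl
  swapAt-involutive zero    (x ∷ y ∷ xs) = refl
  swapAt-involutive (suc n) []           = refl
  swapAt-involutive (suc n) (x ∷ xs)     = cong (x ∷_) (swapAt-involutive n xs)

  length-swapAt : ∀ n (xs : List A) → length (swapAt n xs) ≡ length xs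
  length-swapAt zero    []           = refl
  length-swapAt zero    (x ∷ [])     = refl
  length-swapAt zero    (x ∷ y ∷ xs) = refl
  length-swapAt (suc n) []           = refl
  length-swapAt (suc n) (x ∷ xs)     = cong suc (length-swapAt n xs)

  ∏-swapAt : ∀ (w : A → ℕ) n xs → ∏ (swapAt n xs) w ≡ ∏ xs w
  ∏-swapAt w zero    []           = refl
  ∏-swapAt w zero    (x ∷ [])     = refl
  ∏-swapAt w zero    (x ∷ y ∷ xs) = x∙yz≈y∙xz *-commutativeSemigroup (w y) (w x) (∏ xs w)
  ∏-swapAt w (suc n) []           = refl
  ∏-swapAt w (suc n) (x ∷ xs)     = cong (w x *_) (∏-swapAt w n xs)

map-swapAt : ∀ {A B : Set} (g : A → B) n xs → map g (swapAt n xs) ≡ swapAt n (map g xs)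
map-swapAt g zero    []           = refl
map-swapAt g zero    (x ∷ [])     = refl
map-swapAt g zero    (x ∷ y ∷ xs) = refl
map-swapAt g (suc n) []           = refl
map-swapAt g (suc n) (x ∷ xs)     = cong (g x ∷_) (map-swapAt g n xs)

-- A function on lists that comes from a function on finite sets: adjacent transpositions generate
-- all permutations, and with symmetry a repetition can always be moved to the front.
record IsSetFunction {A : Set} (f : List A → ℕ) : Set where
  field
    swap-invariant  : ∀ n xs → f (swapAt n xs) ≡ f xs
    repeat-vanishes : ∀ x xs → f (x ∷ x ∷ xs) ≡ 0

open IsSetFunction

module _ {A : Set} where

  IsSetFunction-∷ : ∀ {f : List A → ℕ} x → IsSetFunction f → IsSetFunction (f ∘ (x ∷_))
  IsSetFunction-∷ {f} x setf = record
    { swap-invariant  = λ n xs → swap-invariant setf (suc n) (x ∷ xs)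
    ; repeat-vanishes = λ y xs → begin
        f (x ∷ y ∷ y ∷ xs)  ≡⟨ swap-invariant setf 0 (y ∷ x ∷ y ∷ xs) ⟩
        f (y ∷ x ∷ y ∷ xs)  ≡⟨ swap-invariant setf 1 (y ∷ y ∷ x ∷ xs) ⟩
        f (y ∷ y ∷ x ∷ xs)  ≡⟨ repeat-vanishes setf y (x ∷ xs) ⟩
        0                   ∎
    }

  IsSetFunction-*∏ : ∀ {f : List A → ℕ} → IsSetFunction f → ∀ w → IsSetFunction (λ c → f c * ∏ c w)
  IsSetFunction-*∏ setf w = record
    { swap-invariant  = λ n xs → cong₂ _*_ (swap-invariant setf n xs) (∏-swapAt w n xs)
    ; repeat-vanishes = λ x xs → cong (_* ∏ (x ∷ x ∷ xs) w) (repeat-vanishes setf x xs)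
    }

IsSetFunction-∘map : ∀ {A B : Set} {f : List B → ℕ} (g : A → B) → IsSetFunction f → IsSetFunction (f ∘ map g)
IsSetFunction-∘map {f = f} g setf = record
  { swap-invariant  = λ n xs → trans (cong f (map-swapAt g n xs)) (swap-invariant setf n (map g xs))
  ; repeat-vanishes = λ x xs → repeat-vanishes setf (g x) (map g xs)
  }

module _ {A : Set} where

  subsetSum : List A → ℕ → (List A → ℕ) → ℕ
  subsetSum xs d f = ∑ (choose d xs) f

  tupleSum : List A → ℕ → (List A → ℕ) → ℕ
  tupleSum xs d f = ∑[ t ∈ allVecsOf xs d ] f (toList t)

  subsetSum-∷ : ∀ x xs d (f : List A → ℕ) →
                subsetSum (x ∷ xs) (suc d) f ≡ subsetSum xs d (f ∘ (x ∷_)) + subsetSum xs (suc d) f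
  subsetSum-∷ x xs d f = trans (∑-++ f (map (x ∷_) (choose d xs)) (choose (suc d) xs))
                               (cong (_+ subsetSum xs (suc d) f) (∑-map f (x ∷_) (choose d xs)))

  tupleSum-suc : ∀ xs d (f : List A → ℕ) → tupleSum xs (suc d) f ≡ ∑[ x ∈ xs ] tupleSum xs d (f ∘ (x ∷_))
  tupleSum-suc xs d f = trans (∑-concatMap (f ∘ toList) (λ x → map (x ∷_) (allVecsOf xs d)) xs)
                              (∑-cong xs (λ x → ∑-map (f ∘ toList) (x ∷_) (allVecsOf xs d)))

  tupleSum-cong : ∀ {f g : List A → ℕ} xs d → (∀ c → f c ≡ g c) → tupleSum xs d f ≡ tupleSum xs d g
  tupleSum-cong xs d f≗g = ∑-cong (allVecsOf xs d) (f≗g ∘ toList)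

  tupleSum-*ˡ : ∀ a (f : List A → ℕ) xs d → tupleSum xs d (λ c → a * f c) ≡ a * tupleSum xs d f
  tupleSum-*ˡ a f xs d = ∑-*ˡ a (f ∘ toList) (allVecsOf xs d)

  -- A (d+1)-subset arises d+1 times as a point y followed by a d-subset not containing y;
  -- the pairs in which y is repeated contribute nothing.
  subsetSum-pointed : ∀ {f} → IsSetFunction f → ∀ xs d →
                      ∑[ y ∈ xs ] subsetSum xs d (f ∘ (y ∷_)) ≡ suc d * subsetSum xs (suc d) f
  subsetSum-pointed setf []       d = sym (*-zeroʳ (suc d))
  subsetSum-pointed {f} setf (x ∷ xs) zero = begin
    subsetSum xs 0 (f ∘ (x ∷_)) + ∑[ y ∈ xs ] subsetSum xs 0 (f ∘ (y ∷_))
      ≡⟨ cong (subsetSum xs 0 (f ∘ (x ∷_)) +_) (trans (subsetSum-pointed setf xs 0) (*-identityˡ _)) ⟩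
    subsetSum xs 0 (f ∘ (x ∷_)) + subsetSum xs 1 f
      ≡⟨ sym (subsetSum-∷ x xs 0 f) ⟩
    subsetSum (x ∷ xs) 1 f
      ≡⟨ sym (*-identityˡ _) ⟩
    1 * subsetSum (x ∷ xs) 1 f
      ∎
  subsetSum-pointed {f} setf (x ∷ xs) (suc e) = begin
    subsetSum (x ∷ xs) (suc e) (f ∘ (x ∷_)) + ∑[ y ∈ xs ] subsetSum (x ∷ xs) (suc e) (f ∘ (y ∷_))
      ≡⟨ cong₂ _+_ (subsetSum-∷ x xs e (f ∘ (x ∷_))) (∑-cong xs (λ y → subsetSum-∷ x xs e (f ∘ (y ∷_)))) ⟩
    (subsetSum xs e (f ∘ (x ∷_) ∘ (x ∷_)) + a) + ∑[ y ∈ xs ] (subsetSum xs e (f ∘ (y ∷_) ∘ (x ∷_)) + B y)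
      ≡⟨ cong₂ _+_ (cong (_+ a) (∑-zero (choose e xs) (repeat-vanishes setf x)))
                   (∑-+ (λ y → subsetSum xs e (f ∘ (y ∷_) ∘ (x ∷_))) B xs) ⟩
    a + (∑[ y ∈ xs ] subsetSum xs e (f ∘ (y ∷_) ∘ (x ∷_)) + ∑ xs B)
      ≡⟨ cong (λ s → a + (s + ∑ xs B)) (∑-cong xs (λ y → ∑-cong (choose e xs) (λ c → swap-invariant setf 0 (x ∷ y ∷ c)))) ⟩
    a + (∑[ y ∈ xs ] subsetSum xs e (f ∘ (x ∷_) ∘ (y ∷_)) + ∑ xs B)
      ≡⟨ cong (a +_) (cong₂ _+_ (subsetSum-pointed (IsSetFunction-∷ x setf) xs e) (subsetSum-pointed setf xs (suc e))) ⟩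
    a + (suc e * a + suc (suc e) * b)
      ≡⟨ solve 3 (λ a b e → a :+ ((con 1 :+ e) :* a :+ (con 2 :+ e) :* b) := (con 2 :+ e) :* (a :+ b)) refl a b e ⟩
    suc (suc e) * (a + b)
      ≡⟨ cong (suc (suc e) *_) (sym (subsetSum-∷ x xs (suc e) f)) ⟩
    suc (suc e) * subsetSum (x ∷ xs) (suc (suc e)) f
      ∎
    where
    open +-*-Solver
    a : ℕ
    a = subsetSum xs (suc e) (f ∘ (x ∷_))
    b : ℕ
    b = subsetSum xs (suc (suc e)) f
    B : A → ℕ
    B y = subsetSum xs (suc e) (f ∘ (y ∷_))

  tupleSum≡!*subsetSum : ∀ {f} → IsSetFunction f → ∀ xs d → tupleSum xs d f ≡ d ! * subsetSum xs d f
  tupleSum≡!*subsetSum setf xs zero    = sym (*-identityˡ _)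
  tupleSum≡!*subsetSum {f} setf xs (suc d) = begin
    tupleSum xs (suc d) f                              ≡⟨ tupleSum-suc xs d f ⟩
    ∑[ y ∈ xs ] tupleSum xs d (f ∘ (y ∷_))            ≡⟨ ∑-cong xs (λ y → tupleSum≡!*subsetSum (IsSetFunction-∷ y setf) xs d) ⟩
    ∑[ y ∈ xs ] (d ! * subsetSum xs d (f ∘ (y ∷_)))   ≡⟨ ∑-*ˡ (d !) (λ y → subsetSum xs d (f ∘ (y ∷_))) xs ⟩
    d ! * ∑[ y ∈ xs ] subsetSum xs d (f ∘ (y ∷_))     ≡⟨ cong (d ! *_) (subsetSum-pointed setf xs d) ⟩
    d ! * (suc d * subsetSum xs (suc d) f)            ≡⟨ solve 3 (λ p q r → p :* (q :* r) := q :* p :* r) refl (d !) (suc d) (subsetSum xs (suc d) f) ⟩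
    suc d ! * subsetSum xs (suc d) f                  ∎
    where open +-*-Solver

choose-map : ∀ {A B : Set} (h : A → B) d xs → choose d (map h xs) ≡ map (map h) (choose d xs)
choose-map h zero    xs       = refl
choose-map h (suc d) []       = refl
choose-map h (suc d) (x ∷ xs) = begin
  map (h x ∷_) (choose d (map h xs)) ++ choose (suc d) (map h xs)
    ≡⟨ cong₂ _++_ (cong (map (h x ∷_)) (choose-map h d xs)) (choose-map h (suc d) xs) ⟩
  map (h x ∷_) (map (map h) (choose d xs)) ++ map (map h) (choose (suc d) xs)
    ≡⟨ cong (_++ map (map h) (choose (suc d) xs)) (trans (sym (map-∘ (choose d xs))) (map-∘ (choose d xs))) ⟩
  map (map h) (map (x ∷_) (choose d xs)) ++ map (map h) (choose (suc d) xs)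
    ≡⟨ sym (map-++ (map h) (map (x ∷_) (choose d xs)) (choose (suc d) xs)) ⟩
  map (map h) (map (x ∷_) (choose d xs) ++ choose (suc d) xs)
    ∎

subsetSum-map : ∀ {A B : Set} (h : A → B) xs d (f : List B → ℕ) → subsetSum (map h xs) d f ≡ subsetSum xs d (f ∘ map h)
subsetSum-map h xs d f = trans (cong (λ cs → ∑ cs f) (choose-map h d xs)) (∑-map f (map h) (choose d xs))

module _ {A : Set} (_≟_ : DecidableEquality A) where

  multiplicity : List A → A → ℕ
  multiplicity xs y = ∑[ x ∈ xs ] indicator (x ≟ y)

  Enumerates : List A → Set
  Enumerates xs = ∀ y → multiplicity xs y ≡ 1

  private
    indicator-swap : ∀ (h : A → ℕ) x y → indicator (y ≟ x) * h x ≡ h y * indicator (x ≟ y)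
    indicator-swap h x y with x ≟ y | y ≟ x
    ... | yes refl | yes _    = *-comm 1 (h x)
    ... | yes refl | no x≢x   = ⊥-elim (x≢x refl)
    ... | no x≢y   | yes refl = ⊥-elim (x≢y refl)
    ... | no _     | no _     = sym (*-zeroʳ (h y))

  ∑-multiplicity : ∀ xs → Enumerates xs → ∀ ys (h : A → ℕ) → ∑[ x ∈ xs ] (multiplicity ys x * h x) ≡ ∑ ys h
  ∑-multiplicity xs enum []       h = ∑-zero xs (λ _ → refl)
  ∑-multiplicity xs enum (y ∷ ys) h = begin
    ∑[ x ∈ xs ] ((indicator (y ≟ x) + multiplicity ys x) * h x)
      ≡⟨ ∑-cong xs (λ x → *-distribʳ-+ (h x) (indicator (y ≟ x)) (multiplicity ys x)) ⟩
    ∑[ x ∈ xs ] (indicator (y ≟ x) * h x + multiplicity ys x * h x)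
      ≡⟨ ∑-+ (λ x → indicator (y ≟ x) * h x) (λ x → multiplicity ys x * h x) xs ⟩
    ∑[ x ∈ xs ] (indicator (y ≟ x) * h x) + ∑[ x ∈ xs ] (multiplicity ys x * h x)
      ≡⟨ cong₂ _+_ (∑-cong xs (λ x → indicator-swap h x y)) (∑-multiplicity xs enum ys h) ⟩
    ∑[ x ∈ xs ] (h y * indicator (x ≟ y)) + ∑ ys h
      ≡⟨ cong (_+ ∑ ys h) (trans (∑-*ˡ (h y) (λ x → indicator (x ≟ y)) xs) (cong (h y *_) (enum y))) ⟩
    h y * 1 + ∑ ys h
      ≡⟨ cong (_+ ∑ ys h) (*-identityʳ (h y)) ⟩
    h y + ∑ ys h
      ∎

  ∑-multiplicity≡length : ∀ xs → Enumerates xs → ∀ ys → ∑ xs (multiplicity ys) ≡ length ys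
  ∑-multiplicity≡length xs enum ys = begin
    ∑ xs (multiplicity ys)                 ≡⟨ ∑-cong xs (λ x → sym (*-identityʳ _)) ⟩
    ∑[ x ∈ xs ] (multiplicity ys x * 1)    ≡⟨ ∑-multiplicity xs enum ys (λ _ → 1) ⟩
    ∑[ y ∈ ys ] 1                          ≡⟨ ∑-ones ys ⟩
    length ys                              ∎
    where
    ∑-ones : ∀ (ys : List A) → ∑[ y ∈ ys ] 1 ≡ length ys
    ∑-ones []       = refl
    ∑-ones (y ∷ ys) = cong suc (∑-ones ys)

  tupleSum-multiplicity : ∀ xs → Enumerates xs → ∀ ys d (f : List A → ℕ) →
                          tupleSum xs d (λ c → f c * ∏ c (multiplicity ys)) ≡ tupleSum ys d f
  tupleSum-multiplicity xs enum ys zero    f = cong (_+ 0) (*-identityʳ (f []))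
  tupleSum-multiplicity xs enum ys (suc d) f = begin
    tupleSum xs (suc d) (λ c → f c * ∏ c m)
      ≡⟨ tupleSum-suc xs d (λ c → f c * ∏ c m) ⟩
    ∑[ x ∈ xs ] tupleSum xs d (λ c → f (x ∷ c) * (m x * ∏ c m))
      ≡⟨ ∑-cong xs (λ x → tupleSum-cong xs d (λ c → x∙yz≈y∙xz *-commutativeSemigroup (f (x ∷ c)) (m x) (∏ c m))) ⟩
    ∑[ x ∈ xs ] tupleSum xs d (λ c → m x * (f (x ∷ c) * ∏ c m))
      ≡⟨ ∑-cong xs (λ x → tupleSum-*ˡ (m x) (λ c → f (x ∷ c) * ∏ c m) xs d) ⟩
    ∑[ x ∈ xs ] (m x * tupleSum xs d (λ c → f (x ∷ c) * ∏ c m))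
      ≡⟨ ∑-cong xs (λ x → cong (m x *_) (tupleSum-multiplicity xs enum ys d (f ∘ (x ∷_)))) ⟩
    ∑[ x ∈ xs ] (m x * tupleSum ys d (f ∘ (x ∷_)))
      ≡⟨ ∑-multiplicity xs enum ys (λ x → tupleSum ys d (f ∘ (x ∷_))) ⟩
    ∑[ y ∈ ys ] tupleSum ys d (f ∘ (y ∷_))
      ≡⟨ sym (tupleSum-suc ys d f) ⟩
    tupleSum ys (suc d) f
      ∎
    where
    m : A → ℕ
    m = multiplicity ys

_≟ᵛ_ : ∀ {n} → DecidableEquality (Vec Bool n)
_≟ᵛ_ = Vecₚ.≡-dec Boolₚ._≟_

-- Deciding (b ∷ x) ≟ᵛ (c ∷ y) computes to deciding x ≟ᵛ y when b = c, and to "no" otherwise.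
allBVecs-enumerates : ∀ n → Enumerates _≟ᵛ_ (allBVecs n)
allBVecs-enumerates zero    []      = refl
allBVecs-enumerates (suc n) (b ∷ y) = begin
  ∑ (map (false ∷_) vs ++ (map (true ∷_) vs ++ [])) is-b∷y
    ≡⟨ ∑-++ is-b∷y (map (false ∷_) vs) _ ⟩
  ∑ (map (false ∷_) vs) is-b∷y + ∑ (map (true ∷_) vs ++ []) is-b∷y
    ≡⟨ cong₂ _+_ (∑-map is-b∷y (false ∷_) vs) (trans (∑-++ is-b∷y (map (true ∷_) vs) []) (cong (_+ 0) (∑-map is-b∷y (true ∷_) vs))) ⟩
  ∑[ x ∈ vs ] indicator ((false ∷ x) ≟ᵛ (b ∷ y)) + (∑[ x ∈ vs ] indicator ((true ∷ x) ≟ᵛ (b ∷ y)) + 0)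
    ≡⟨ by-head b ⟩
  1 ∎
  where
  vs : List (Vec Bool n)
  vs = allBVecs n
  is-b∷y : Vec Bool (suc n) → ℕ
  is-b∷y x = indicator (x ≟ᵛ (b ∷ y))
  by-head : ∀ b → ∑[ x ∈ vs ] indicator ((false ∷ x) ≟ᵛ (b ∷ y)) + (∑[ x ∈ vs ] indicator ((true ∷ x) ≟ᵛ (b ∷ y)) + 0) ≡ 1
  by-head false = cong₂ _+_ (allBVecs-enumerates n y) (cong (_+ 0) (∑-zero vs (λ _ → refl)))
  by-head true  = cong₂ _+_ (∑-zero vs (λ _ → refl)) (cong (_+ 0) (allBVecs-enumerates n y))

length-allBVecs : ∀ n → length (allBVecs n) ≡ 2 ^ n
length-allBVecs zero    = refl
length-allBVecs (suc n) = begin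
  length (map (false ∷_) vs ++ (map (true ∷_) vs ++ []))         ≡⟨ length-++ (map (false ∷_) vs) ⟩
  length (map (false ∷_) vs) + length (map (true ∷_) vs ++ [])   ≡⟨ cong₂ _+_ (length-map (false ∷_) vs)
                                                                       (trans (length-++ (map (true ∷_) vs)) (cong (_+ 0) (length-map (true ∷_) vs))) ⟩
  length vs + (length vs + 0)                                    ≡⟨ cong (λ l → l + (l + 0)) (length-allBVecs n) ⟩
  2 ^ suc n                                                      ∎
  where
  vs : List (Vec Bool n)
  vs = allBVecs n

nonzeroBVecs : (n : ℕ) → List (Vec Bool n)
nonzeroBVecs n = drop 1 (allBVecs n)

allBVecs≡zero∷nonzeroBVecs : ∀ n → allBVecs n ≡ Vec.replicate n false ∷ nonzeroBVecs n
allBVecs≡zero∷nonzeroBVecs zero    = refl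
allBVecs≡zero∷nonzeroBVecs (suc n) = extend (allBVecs n) (allBVecs≡zero∷nonzeroBVecs n)
  where
  extend : ∀ vs → vs ≡ Vec.replicate n false ∷ drop 1 vs →
           map (false ∷_) vs ++ (map (true ∷_) vs ++ [])
             ≡ (false ∷ Vec.replicate n false) ∷ drop 1 (map (false ∷_) vs ++ (map (true ∷_) vs ++ []))
  extend (v ∷ vs) refl = refl

length-nonzeroBVecs : ∀ n → length (nonzeroBVecs n) ≡ 2 ^ n ∸ 1
length-nonzeroBVecs n = trans (length-drop 1 (allBVecs n)) (cong (_∸ 1) (length-allBVecs n))

module _ {k : ℕ} where

  shatteredIndicator : ℕ → List (Vec Bool k) → ℕ
  shatteredIndicator d cols = indicator (shattered? d cols)

  Shattered-length : ∀ {d} (cols : List (Vec Bool k)) → Shattered d cols → length cols ≡ d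
  Shattered-length {d} cols sh = begin
    length cols                               ≡⟨ sym (length-map (λ c → lookup c i) cols) ⟩
    length (rowOf cols i)                     ≡⟨ cong length (proj₂ (sh zeros)) ⟩
    length (toList zeros)                     ≡⟨ Vecₚ.length-toList zeros ⟩
    d                                         ∎
    where
    zeros : Vec Bool d
    zeros = Vec.replicate d false
    i : Fin k
    i = proj₁ (sh zeros)

  Shattered-swapAt : ∀ {d} n (cols : List (Vec Bool k)) → Shattered d cols → Shattered d (swapAt n cols)
  Shattered-swapAt {d} n cols sh v = i , (begin
    rowOf (swapAt n cols) i         ≡⟨ map-swapAt (λ c → lookup c i) n cols ⟩
    swapAt n (rowOf cols i)         ≡⟨ cong (swapAt n) (trans (proj₂ (sh v′)) toList-v′) ⟩
    swapAt n (swapAt n (toList v))  ≡⟨ swapAt-involutive n (toList v) ⟩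
    toList v                        ∎)
    where
    v′ : Vec Bool d
    v′ = Vec.cast (trans (length-swapAt n (toList v)) (Vecₚ.length-toList v)) (Vec.fromList (swapAt n (toList v)))
    toList-v′ : toList v′ ≡ swapAt n (toList v)
    toList-v′ = trans (Vecₚ.toList-cast _ _) (Vecₚ.toList∘fromList _)
    i : Fin k
    i = proj₁ (sh v′)

  ¬Shattered-repeat : ∀ {d} c (cols : List (Vec Bool k)) → ¬ Shattered d (c ∷ c ∷ cols)
  ¬Shattered-repeat c cols sh with Shattered-length (c ∷ c ∷ cols) sh
  ... | refl with sh (true ∷ false ∷ Vec.replicate (length cols) false)
  ...   | i , row≡ with trans (sym (∷-injectiveˡ row≡)) (∷-injectiveˡ (∷-injectiveʳ row≡))
  ...     | ()

  ¬Shattered-zero-column : ∀ {d} c (cols : List (Vec Bool k)) → (∀ i → lookup c i ≡ false) →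
                           ¬ Shattered (suc d) (c ∷ cols)
  ¬Shattered-zero-column {d} c cols c≡0 sh with sh (true ∷ Vec.replicate d false)
  ... | i , row≡ with trans (sym (c≡0 i)) (∷-injectiveˡ row≡)
  ...   | ()

  shattered-isSetFunction : ∀ d → IsSetFunction (shatteredIndicator d)
  shattered-isSetFunction d = record
    { swap-invariant  = λ n cols → indicator-⇔ (mk⇔ (unswap n cols) (Shattered-swapAt n cols))
                                               (shattered? d (swapAt n cols)) (shattered? d cols)
    ; repeat-vanishes = λ c cols → indicator-no (¬Shattered-repeat c cols) (shattered? d (c ∷ c ∷ cols))
    }
    where
    unswap : ∀ n cols → Shattered d (swapAt n cols) → Shattered d cols
    unswap n cols sh = subst (Shattered d) (swapAt-involutive n cols) (Shattered-swapAt n (swapAt n cols) sh)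

  numShattered≡subsetSum : ∀ {m} d (M : Vec (Vec Bool k) m) →
                           numShattered d M ≡ subsetSum (toList M) d (shatteredIndicator d)
  numShattered≡subsetSum d M = length-filter (shattered? d) (choose d (toList M))

  subsetSum-shattered-multiplicity : ∀ d (cols : List (Vec Bool k)) →
    subsetSum (allBVecs k) d (λ e → shatteredIndicator d e * ∏ e (multiplicity _≟ᵛ_ cols))
      ≡ subsetSum cols d (shatteredIndicator d)
  subsetSum-shattered-multiplicity d cols = *-cancelˡ-≡ _ _ (d !) {{d !≢0}} (begin
    d ! * subsetSum (allBVecs k) d (λ e → shatteredIndicator d e * ∏ e m)
      ≡⟨ sym (tupleSum≡!*subsetSum (IsSetFunction-*∏ (shattered-isSetFunction d) m) (allBVecs k) d) ⟩
    tupleSum (allBVecs k) d (λ e → shatteredIndicator d e * ∏ e m)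
      ≡⟨ tupleSum-multiplicity _≟ᵛ_ (allBVecs k) (allBVecs-enumerates k) cols d (shatteredIndicator d) ⟩
    tupleSum cols d (shatteredIndicator d)
      ≡⟨ tupleSum≡!*subsetSum (shattered-isSetFunction d) cols d ⟩
    d ! * subsetSum cols d (shatteredIndicator d)
      ∎)
    where
    m : Vec Bool k → ℕ
    m = multiplicity _≟ᵛ_ cols

module _ where
  open import Data.Integer using (+_) renaming (_*_ to _*ℤ_; _+_ to _+ℤ_)
  open import Data.Integer.Properties using (pos-*; pos-+)
  open import Data.Integer.Solver renaming (module +-*-Solver to ℤ-Solver)

  private
    fromℚᵘ-homo-* : ∀ p q → fromℚᵘ (p *ᵘ q) ≡ fromℚᵘ p *ℚ fromℚᵘ q
    fromℚᵘ-homo-* p q = ℚ.toℚᵘ-injective (ℚᵘ.≃-trans (ℚ.toℚᵘ-fromℚᵘ (p *ᵘ q))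
      (ℚᵘ.≃-trans (ℚᵘ.*-cong (ℚᵘ.≃-sym (ℚ.toℚᵘ-fromℚᵘ p)) (ℚᵘ.≃-sym (ℚ.toℚᵘ-fromℚᵘ q)))
                  (ℚᵘ.≃-sym (ℚ.toℚᵘ-homo-* (fromℚᵘ p) (fromℚᵘ q)))))

    fromℚᵘ-homo-+ : ∀ p q → fromℚᵘ (p +ᵘ q) ≡ fromℚᵘ p +ℚ fromℚᵘ q
    fromℚᵘ-homo-+ p q = ℚ.toℚᵘ-injective (ℚᵘ.≃-trans (ℚ.toℚᵘ-fromℚᵘ (p +ᵘ q))
      (ℚᵘ.≃-trans (ℚᵘ.+-cong (ℚᵘ.≃-sym (ℚ.toℚᵘ-fromℚᵘ p)) (ℚᵘ.≃-sym (ℚ.toℚᵘ-fromℚᵘ q)))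
                  (ℚᵘ.≃-sym (ℚ.toℚᵘ-homo-+ (fromℚᵘ p) (fromℚᵘ q)))))

  -- On a nonzero denominator, frac a m is definitionally fromℚᵘ (mkℚᵘ (+ a) (m ∸ 1)).
  frac-cross : ∀ a b m n .{{_ : NonZero m}} .{{_ : NonZero n}} → a * n ≡ b * m → frac a m ≡ frac b n
  frac-cross a b (suc m) (suc n) eq = ℚ.fromℚᵘ-cong {mkℚᵘ (+ a) m} {mkℚᵘ (+ b) n}
    (*≡* (trans (sym (pos-* a (suc n))) (trans (cong +_ eq) (pos-* b (suc m)))))

  frac-* : ∀ a b m n .{{_ : NonZero m}} .{{_ : NonZero n}} → frac a m *ℚ frac b n ≡ frac (a * b) (m * n)
  frac-* a b (suc m) (suc n) = trans (sym (fromℚᵘ-homo-* (mkℚᵘ (+ a) m) (mkℚᵘ (+ b) n)))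
                                     (cong (λ z → fromℚᵘ (mkℚᵘ z (n + m * suc n))) (sym (pos-* a b)))

  frac-+ : ∀ a b m .{{_ : NonZero m}} → frac a m +ℚ frac b m ≡ frac (a + b) m
  frac-+ a b (suc m) = trans (sym (fromℚᵘ-homo-+ (mkℚᵘ (+ a) m) (mkℚᵘ (+ b) m)))
                             (ℚ.fromℚᵘ-cong {mkℚᵘ (+ a) m +ᵘ mkℚᵘ (+ b) m} {mkℚᵘ (+ (a + b)) m} (*≡* cross))
    where
    open ℤ-Solver
    cross : (+ a *ℤ + suc m +ℤ + b *ℤ + suc m) *ℤ + suc m ≡ + (a + b) *ℤ + (suc m * suc m)
    cross = trans (solve 3 (λ A B M → (A :* M :+ B :* M) :* M := (A :+ B) :* (M :* M)) refl (+ a) (+ b) (+ suc m))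
                  (sym (cong₂ _*ℤ_ (pos-+ a b) (pos-* (suc m) (suc m))))

  frac-zero : ∀ m → frac 0 m ≡ 0ℚ
  frac-zero zero    = refl
  frac-zero (suc m) = ℚ.0/n≡0 (suc m)

  frac-nonneg : ∀ a m → 0ℚ ≤ℚ frac a m
  frac-nonneg a zero    = ℚ.≤-refl
  frac-nonneg a (suc m) = ℚ.nonNegative⁻¹ _ {{ℚ.normalize-nonNeg a (suc m)}}

module _ (m : ℕ) .{{m≢0 : NonZero m}} where

  sumℚ-frac : ∀ {A : Set} (f : A → ℕ) xs → sumℚ (map (λ x → frac (f x) m) xs) ≡ frac (∑ xs f) m
  sumℚ-frac f []       = sym (frac-zero m)
  sumℚ-frac f (x ∷ xs) = trans (cong (frac (f x) m +ℚ_) (sumℚ-frac f xs)) (frac-+ (f x) (∑ xs f) m {{m≢0}})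

  prodℚ-frac : ∀ {A : Set} (w : A → ℕ) xs → prodℚ (map (λ x → frac (w x) m) xs) ≡ frac (∏ xs w) (m ^ length xs)
  prodℚ-frac w []       = refl
  prodℚ-frac w (x ∷ xs) = trans (cong (frac (w x) m *ℚ_) (prodℚ-frac w xs))
                                (frac-* (w x) (∏ xs w) m (m ^ length xs) {{m≢0}} {{m^n≢0 m (length xs)}})

  powℚ-frac : ∀ a d → powℚ (frac a m) d ≡ frac (a ^ d) (m ^ d)
  powℚ-frac a zero    = refl
  powℚ-frac a (suc d) = trans (cong (frac a m *ℚ_) (powℚ-frac a d)) (frac-* a (a ^ d) m (m ^ d) {{m≢0}} {{m^n≢0 m d}})

  powℚ-frac-*-frac : ∀ a n d .{{_ : NonZero a}} → powℚ (frac a m) d *ℚ frac n (a ^ d) ≡ frac n (m ^ d)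
  powℚ-frac-*-frac a n d = begin
    powℚ (frac a m) d *ℚ frac n (a ^ d)       ≡⟨ cong (_*ℚ frac n (a ^ d)) (powℚ-frac a d) ⟩
    frac (a ^ d) (m ^ d) *ℚ frac n (a ^ d)    ≡⟨ frac-* (a ^ d) n (m ^ d) (a ^ d) {{m^n≢0 m d}} {{m^n≢0 a d}} ⟩
    frac (a ^ d * n) (m ^ d * a ^ d)          ≡⟨ frac-cross _ _ _ _ {{m*n≢0 (m ^ d) (a ^ d) {{m^n≢0 m d}} {{m^n≢0 a d}}}} {{m^n≢0 m d}}
                                                   (solve 3 (λ p q r → p :* q :* r := q :* (r :* p)) refl (a ^ d) n (m ^ d)) ⟩
    frac n (m ^ d)                            ∎
    where open +-*-Solver

  lagPoly-frac : ∀ k d (w : Vec Bool k → ℕ) →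
    lagPoly k d (λ v → frac (w v) m) ≡ frac (subsetSum (allBVecs k) d (λ e → shatteredIndicator d e * ∏ e w)) (m ^ d)
  lagPoly-frac k d w =
    trans (sumℚ-prodℚ-frac (edgesH k d) (All.map (λ {e} → Shattered-length e) (all-filter (shattered? d) subsets)))
          (cong (λ z → frac z (m ^ d)) (∑-filter (shattered? d) (λ e → ∏ e w) subsets))
    where
    subsets : List (List (Vec Bool k))
    subsets = choose d (allBVecs k)
    sumℚ-prodℚ-frac : ∀ es → All (λ e → length e ≡ d) es →
      sumℚ (map (λ e → prodℚ (map (λ v → frac (w v) m) e)) es) ≡ frac (∑ es (λ e → ∏ e w)) (m ^ d)
    sumℚ-prodℚ-frac []       []           = sym (frac-zero (m ^ d))
    sumℚ-prodℚ-frac (e ∷ es) (|e|≡d ∷ ps) =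
      trans (cong₂ _+ℚ_ (trans (prodℚ-frac w e) (cong (λ n → frac (∏ e w) (m ^ n)) |e|≡d)) (sumℚ-prodℚ-frac es ps))
            (frac-+ (∏ e w) (∑ es (λ e → ∏ e w)) (m ^ d) {{m^n≢0 m d}})

cAtLeast-attained : ∀ k d (x : Vec Bool k → ℚ) → (∀ v → 0ℚ ≤ℚ x v) → sumℚ (map x (allBVecs k)) ≡ 1ℚ →
                    cAtLeast k d (ℕtoℚ (d !) *ℚ lagPoly k d x)
cAtLeast-attained k d x x≥0 ∑x≡1 ε ε>0 = x , x≥0 , ∑x≡1 , subst (_<ℚ r +ℚ ε) (ℚ.+-identityʳ r) (ℚ.+-monoʳ-< r ε>0)
  where
  r : ℚ
  r = ℕtoℚ (d !) *ℚ lagPoly k d x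

dot-zeroˡ : ∀ {n} (x : Vec Bool n) → dot (Vec.replicate n false) x ≡ false
dot-zeroˡ []      = refl
dot-zeroˡ (b ∷ x) = dot-zeroˡ x

module _ {d' k : ℕ} (S : Vec (Vec Bool d') k) where

  pairing : Vec Bool d' → Vec Bool k
  pairing u = Vec.tabulate (λ i → dot u (lookup S i))

  pairingMatrix : Vec (Vec Bool k) (2 ^ d' ∸ 1)
  pairingMatrix = Vec.cast (trans (length-map pairing (nonzeroBVecs d')) (length-nonzeroBVecs d'))
                           (Vec.fromList (map pairing (nonzeroBVecs d')))

  toList-pairingMatrix : toList pairingMatrix ≡ map pairing (nonzeroBVecs d')
  toList-pairingMatrix = trans (Vecₚ.toList-cast _ _) (Vecₚ.toList∘fromList _)

  rowOf-pairing : ∀ {d} (A : LinMap d d') i → rowOf (map pairing (toList A)) i ≡ toList (apply A (lookup S i))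
  rowOf-pairing A i = begin
    map (λ c → lookup c i) (map pairing (toList A))  ≡⟨ sym (map-∘ (toList A)) ⟩
    map (λ u → lookup (pairing u) i) (toList A)      ≡⟨ map-cong (λ u → Vecₚ.lookup∘tabulate _ i) (toList A) ⟩
    map (λ u → dot u (lookup S i)) (toList A)        ≡⟨ sym (Vecₚ.toList-map _ A) ⟩
    toList (apply A (lookup S i))                    ∎

  mapsOnto⇔shattered : ∀ {d} (A : LinMap d d') → MapsOnto S A ⇔ Shattered d (map pairing (toList A))
  mapsOnto⇔shattered A = mk⇔
    (λ onto v → map₂ (λ {i} Asᵢ≡v → trans (rowOf-pairing A i) (cong toList Asᵢ≡v)) (onto v))
    (λ sh y → map₂ (λ {i} row≡y → trans (sym (Vecₚ.cast-is-id refl _))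
                                         (Vecₚ.toList-injective refl _ y (trans (sym (rowOf-pairing A i)) row≡y)))
                   (sh y))

  shatteredByPairing : ℕ → List (Vec Bool d') → ℕ
  shatteredByPairing d us = shatteredIndicator d (map pairing us)

  numOnto≡!*subsetSum : ∀ d → numOnto d S ≡ d ! * subsetSum (allBVecs d') d (shatteredByPairing d)
  numOnto≡!*subsetSum d = begin
    numOnto d S
      ≡⟨ length-filter (mapsOnto? S) (allLinMaps d d') ⟩
    ∑[ A ∈ allLinMaps d d' ] indicator (mapsOnto? S A)
      ≡⟨ ∑-cong (allLinMaps d d') (λ A → indicator-⇔ (mapsOnto⇔shattered A) (mapsOnto? S A) (shattered? d (map pairing (toList A)))) ⟩
    tupleSum (allBVecs d') d (shatteredByPairing d)
      ≡⟨ tupleSum≡!*subsetSum (IsSetFunction-∘map pairing (shattered-isSetFunction d)) (allBVecs d') d ⟩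
    d ! * subsetSum (allBVecs d') d (shatteredByPairing d)
      ∎

  -- The zero functional gives a zero column, which lies in no shattered submatrix.
  subsetSum-allBVecs≡nonzeroBVecs : ∀ e → subsetSum (allBVecs d') (suc e) (shatteredByPairing (suc e))
                                          ≡ subsetSum (nonzeroBVecs d') (suc e) (shatteredByPairing (suc e))
  subsetSum-allBVecs≡nonzeroBVecs e = begin
    subsetSum (allBVecs d') (suc e) f
      ≡⟨ cong (λ vs → subsetSum vs (suc e) f) (allBVecs≡zero∷nonzeroBVecs d') ⟩
    subsetSum (zeros ∷ nonzeroBVecs d') (suc e) f
      ≡⟨ subsetSum-∷ zeros (nonzeroBVecs d') e f ⟩
    subsetSum (nonzeroBVecs d') e (f ∘ (zeros ∷_)) + subsetSum (nonzeroBVecs d') (suc e) f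
      ≡⟨ cong (_+ subsetSum (nonzeroBVecs d') (suc e) f) (∑-zero (choose e (nonzeroBVecs d')) zero-column-unshattered) ⟩
    subsetSum (nonzeroBVecs d') (suc e) f
      ∎
    where
    f : List (Vec Bool d') → ℕ
    f = shatteredByPairing (suc e)
    zeros : Vec Bool d'
    zeros = Vec.replicate d' false
    zero-column-unshattered : ∀ us → f (zeros ∷ us) ≡ 0
    zero-column-unshattered us = indicator-no
      (¬Shattered-zero-column (pairing zeros) (map pairing us) (λ i → trans (Vecₚ.lookup∘tabulate _ i) (dot-zeroˡ (lookup S i))))
      (shattered? (suc e) (pairing zeros ∷ map pairing us))

  numShattered-pairingMatrix : ∀ e → numShattered (suc e) pairingMatrix * suc e ! ≡ numOnto (suc e) S
  numShattered-pairingMatrix e = begin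
    numShattered d pairingMatrix * d !
      ≡⟨ cong (_* d !) (numShattered≡subsetSum d pairingMatrix) ⟩
    subsetSum (toList pairingMatrix) d (shatteredIndicator d) * d !
      ≡⟨ cong (λ cs → subsetSum cs d (shatteredIndicator d) * d !) toList-pairingMatrix ⟩
    subsetSum (map pairing (nonzeroBVecs d')) d (shatteredIndicator d) * d !
      ≡⟨ cong (_* d !) (trans (subsetSum-map pairing (nonzeroBVecs d') d (shatteredIndicator d)) (sym (subsetSum-allBVecs≡nonzeroBVecs e))) ⟩
    subsetSum (allBVecs d') d (shatteredByPairing d) * d !
      ≡⟨ trans (*-comm _ (d !)) (sym (numOnto≡!*subsetSum d)) ⟩
    numOnto d S
      ∎
    where
    d : ℕ
    d = suc e

  module _ .{{N≢0 : NonZero (2 ^ d' ∸ 1)}} where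

    private
      N : ℕ
      N = 2 ^ d' ∸ 1
      m : Vec Bool k → ℕ
      m = multiplicity _≟ᵛ_ (toList pairingMatrix)

    columnFrequency : Vec Bool k → ℚ
    columnFrequency v = frac (m v) N

    columnFrequency-sum : sumℚ (map columnFrequency (allBVecs k)) ≡ 1ℚ
    columnFrequency-sum = begin
      sumℚ (map columnFrequency (allBVecs k))  ≡⟨ sumℚ-frac N m (allBVecs k) ⟩
      frac (∑ (allBVecs k) m) N                ≡⟨ cong (λ z → frac z N) (trans (∑-multiplicity≡length _≟ᵛ_ (allBVecs k) (allBVecs-enumerates k) (toList pairingMatrix))
                                                                                (Vecₚ.length-toList pairingMatrix)) ⟩
      frac N N                                 ≡⟨ frac-cross N 1 N 1 (*-comm N 1) ⟩
      1ℚ                                       ∎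

    lagPoly-columnFrequency : ∀ e → ℕtoℚ (suc e !) *ℚ lagPoly k (suc e) columnFrequency ≡ frac (numOnto (suc e) S) (N ^ suc e)
    lagPoly-columnFrequency e = begin
      ℕtoℚ (d !) *ℚ lagPoly k d columnFrequency
        ≡⟨ cong (ℕtoℚ (d !) *ℚ_) (lagPoly-frac N k d m) ⟩
      frac (d !) 1 *ℚ frac (subsetSum (allBVecs k) d (λ c → shatteredIndicator d c * ∏ c m)) (N ^ d)
        ≡⟨ frac-* (d !) _ 1 (N ^ d) {{_}} {{m^n≢0 N d}} ⟩
      frac (d ! * subsetSum (allBVecs k) d (λ c → shatteredIndicator d c * ∏ c m)) (1 * N ^ d)
        ≡⟨ cong₂ frac (cong (d ! *_) (subsetSum-shattered-multiplicity d (toList pairingMatrix))) (*-identityˡ (N ^ d)) ⟩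
      frac (d ! * subsetSum (toList pairingMatrix) d (shatteredIndicator d)) (N ^ d)
        ≡⟨ cong (λ z → frac (d ! * z) (N ^ d)) (sym (numShattered≡subsetSum d pairingMatrix)) ⟩
      frac (d ! * numShattered d pairingMatrix) (N ^ d)
        ≡⟨ cong (λ z → frac z (N ^ d)) (trans (*-comm (d !) _) (numShattered-pairingMatrix e)) ⟩
      frac (numOnto d S) (N ^ d)
        ∎
      where
      d : ℕ
      d = suc e

lemma5p1 : (d k d' : ℕ) → 1 ≤ d → 2 ^ d ≤ k → 1 ≤ d' →
    (S : Vec (Vec Bool d') k) →
    ((i j : Fin k) → lookup S i ≡ lookup S j → i ≡ j) →
    Σ (Vec (Vec Bool k) (2 ^ d' ∸ 1))
      (λ M → numShattered d M * d ! ≡ numOnto d S)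
    × cAtLeast k d
        (powℚ (frac (2 ^ d') (2 ^ d' ∸ 1)) d
          *ℚ frac (numOnto d S) (2 ^ (d * d')))
lemma5p1 (suc e) k d' (s≤s z≤n) _ 1≤d' S _ =
  (pairingMatrix S , numShattered-pairingMatrix S e) ,
  subst (cAtLeast k d) (sym bound≡)
    (subst (cAtLeast k d) (lagPoly-columnFrequency S e)
      (cAtLeast-attained k d (columnFrequency S) (λ v → frac-nonneg _ N) (columnFrequency-sum S)))
  where
  d : ℕ
  d = suc e
  N : ℕ
  N = 2 ^ d' ∸ 1
  instance
    N≢0 : NonZero N
    N≢0 = >-nonZero (∸-monoˡ-≤ 1 (^-monoʳ-≤ 2 1≤d'))
  bound≡ : powℚ (frac (2 ^ d') N) d *ℚ frac (numOnto d S) (2 ^ (d * d')) ≡ frac (numOnto d S) (N ^ d)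
  bound≡ = trans (cong (λ q → powℚ (frac (2 ^ d') N) d *ℚ frac (numOnto d S) q)
                       (trans (cong (2 ^_) (*-comm d d')) (sym (^-*-assoc 2 d' d))))
                 (powℚ-frac-*-frac N (2 ^ d') (numOnto d S) d {{m^n≢0 2 d'}})
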